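{- For every integer $n\ge 1$, $$\varphi(1+\varphi(2+\varphi(3+\cdots+\varphi(n)\cdots)))=\begin{cases}1 & n=1,2,\\ 2 & n=3,4,\\ 4 & n\ge 5.\end{cases}$$
   Context: $\varphi$ denotes Euler's totient function. Precisely, the left-hand side is $x_0$, where $x_n=0$ and $x_{k-1}=\varphi(k+x_k)$ for $k=n,n-1,\dots,1$. -}

module Defs where

open import Data.Nat using (ℕ; zero; suc; _+_; _≟_)
open import Data.Nat.GCD using (gcd)
open import Data.List using (List; length; filter)
open import Data.List.Base using (upTo)
open import Relation.Nullary.Decidable using (⌊_⌋)
open import Data.Bool using (Bool)

-- Euler's totient: φ n = #{ k : 1 ≤ k ≤ n , gcd(k, n) = 1 }  (so φ 0 = 0)
φ : ℕ → ℕ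
φ n = length (filter (λ k → gcd (suc k) n ≟ 1) (upTo n))

tower : ℕ → ℕ → ℕ
tower k zero = 0
tower k (suc m) = φ (k + tower (suc k) m)

nestedTotient : ℕ → ℕ
nestedTotient n = tower 1 n

{-# OPTIONS --safe #-}
-- Write T k for the tail φ(k + φ(k+1 + ⋯)), so T k = φ(k + T (k+1)).  Since φ m is even
-- for m ≥ 3 (the units i and m − i pair up), T k is even once k ≥ 3.  For even k the
-- number k + T (k+1) is then even, and a unit modulo an even number is odd, so
-- T k ≤ (k + T (k+1)) / 2; for odd k only T k ≤ k + T (k+1) is available.  Alternating
-- the two bounds gives T k ≤ 2k + 5 for even k and T k ≤ 3k + 7 for odd k, whatever the
-- depth of the tower.  Hence x₀ = φ(1 + φ(2 + ⋯ φ(7 + T 8))) with T 8 ≤ 21, and these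
-- 22 values, together with the towers of depth at most 6, are computed.
module Submission where

open import Defs
open import Data.Nat using (ℕ; _≤_)
open import Relation.Binary.PropositionalEquality using (_≡_)
open import Data.Product using (_×_)

open import Level using (Level)
open import Function using (_∘_; id)
open import Data.Bool using (Bool; true; false)
open import Data.Product using (_,_)
open import Data.Nat using (zero; suc; _+_; _*_; _∸_; _≟_; z≤n; s≤s)
open import Data.Nat.Properties
  using (≤-refl; ≤-trans; ≤-reflexive; m≤m+n; m+[n∸m]≡n; +-suc; +-assoc; +-identityʳ; +-comm;
         +-monoʳ-≤; +-mono-≤; *-monoʳ-≤; *-distribˡ-+; *-suc; *-cancelˡ-≤; allUpTo?;
         module ≤-Reasoning)
open import Data.Nat.Divisibility using (_∣_; _∣0; ∣-refl; ∣1⇒≡1; ∣m∣n⇒∣m+n; ∣m+n∣m⇒∣n; m∣m*n)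
open import Data.Nat.GCD using (gcd; gcd-greatest; gcd[m,n]∣m; gcd[m,n]∣n)
open import Data.Nat.Tactic.RingSolver using (solve-∀)
open import Data.List using (length; filter; applyUpTo; upTo)
open import Data.List.Properties using (length-filter; length-upTo)
open import Relation.Nullary using (does; map′; contradiction)
open import Relation.Nullary.Decidable using (dec-false; does-≡; from-yes)
open import Relation.Unary using (Pred; Decidable)
open import Relation.Binary.PropositionalEquality
  using (_≢_; refl; sym; trans; cong; subst; module ≡-Reasoning)

indicator : Bool → ℕ
indicator true  = 1
indicator false = 0

indicator≤1 : ∀ b → indicator b ≤ 1
indicator≤1 true  = ≤-refl
indicator≤1 false = z≤n

count : (ℕ → Bool) → ℕ → ℕ
count p zero    = 0
count p (suc n) = indicator (p 0) + count (p ∘ suc) n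

count-snoc : ∀ p n → count p (suc n) ≡ count p n + indicator (p n)
count-snoc p zero    = +-identityʳ (indicator (p 0))
count-snoc p (suc n) = trans (cong (indicator (p 0) +_) (count-snoc (p ∘ suc) n))
                             (sym (+-assoc (indicator (p 0)) _ _))

length-filter-applyUpTo : ∀ {a p : Level} {A : Set a} {P : Pred A p} (P? : Decidable P) f n →
                          length (filter P? (applyUpTo f n)) ≡ count (does ∘ P? ∘ f) n
length-filter-applyUpTo P? f zero = refl
length-filter-applyUpTo P? f (suc n) with does (P? (f 0))
... | true  = cong suc (length-filter-applyUpTo P? (f ∘ suc) n)
... | false = length-filter-applyUpTo P? (f ∘ suc) n

count-palindrome-even : ∀ p n → (∀ i j → suc (i + j) ≡ n → p i ≡ p j) →
                        (∀ i → suc (i + i) ≡ n → p i ≡ false) → 2 ∣ count p n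
count-palindrome-even p zero          _   _   = 2 ∣0
count-palindrome-even p (suc zero)    _   mid rewrite mid 0 refl = 2 ∣0
count-palindrome-even p (suc (suc n)) pal mid = subst (2 ∣_) (sym count≡)
  (∣m∣n⇒∣m+n (count-palindrome-even (p ∘ suc) n pal′ mid′) (m∣m*n (indicator (p 0))))
  where
  pal′ : ∀ i j → suc (i + j) ≡ n → p (suc i) ≡ p (suc j)
  pal′ i j eq = pal (suc i) (suc j) (cong (2 +_) (trans (+-suc i j) eq))
  mid′ : ∀ i → suc (i + i) ≡ n → p (suc i) ≡ false
  mid′ i eq = mid (suc i) (cong (2 +_) (trans (+-suc i i) eq))
  rearrange : ∀ x c → x + (c + x) ≡ c + 2 * x
  rearrange = solve-∀
  count≡ : count p (2 + n) ≡ count (p ∘ suc) n + 2 * indicator (p 0)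
  count≡ = begin
    indicator (p 0) + count (p ∘ suc) (suc n)
      ≡⟨ cong (indicator (p 0) +_) (count-snoc (p ∘ suc) n) ⟩
    indicator (p 0) + (count (p ∘ suc) n + indicator (p (suc n)))
      ≡⟨ cong (λ b → indicator (p 0) + (count (p ∘ suc) n + indicator b))
              (sym (pal 0 (suc n) refl)) ⟩
    indicator (p 0) + (count (p ∘ suc) n + indicator (p 0))
      ≡⟨ rearrange (indicator (p 0)) (count (p ∘ suc) n) ⟩
    count (p ∘ suc) n + 2 * indicator (p 0) ∎
    where open ≡-Reasoning

count-odd-vanishing-≤-half : ∀ p n → (∀ {i} → 2 ∣ suc i → p i ≡ false) → 2 ∣ n →
                             2 * count p n ≤ n
count-odd-vanishing-≤-half p zero          _      _     = z≤n
count-odd-vanishing-≤-half p (suc zero)    _      2∣1   = contradiction (∣1⇒≡1 2∣1) λ ()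
count-odd-vanishing-≤-half p (suc (suc n)) vanish 2∣2+n rewrite vanish {1} ∣-refl = begin
  2 * (indicator (p 0) + count (p ∘ suc ∘ suc) n)
    ≡⟨ *-distribˡ-+ 2 (indicator (p 0)) _ ⟩
  2 * indicator (p 0) + 2 * count (p ∘ suc ∘ suc) n
    ≤⟨ +-mono-≤ (*-monoʳ-≤ 2 (indicator≤1 (p 0)))
                (count-odd-vanishing-≤-half (p ∘ suc ∘ suc) n vanish′ 2∣n) ⟩
  2 + n ∎
  where
  open ≤-Reasoning
  vanish′ : ∀ {i} → 2 ∣ suc i → p (suc (suc i)) ≡ false
  vanish′ 2∣1+i = vanish (∣m∣n⇒∣m+n ∣-refl 2∣1+i)
  2∣n : 2 ∣ n
  2∣n = ∣m+n∣m⇒∣n 2∣2+n ∣-refl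

gcd≡1-complement : ∀ {i j m} → i + j ≡ m → gcd i m ≡ 1 → gcd j m ≡ 1
gcd≡1-complement {i} {j} {m} i+j≡m gcd[i,m]≡1 =
  ∣1⇒≡1 (subst (gcd j m ∣_) gcd[i,m]≡1 (gcd-greatest d∣i (gcd[m,n]∣n j m)))
  where
  d∣i : gcd j m ∣ i
  d∣i = ∣m+n∣m⇒∣n (subst (gcd j m ∣_) (trans (sym i+j≡m) (+-comm i j)) (gcd[m,n]∣n j m))
                  (gcd[m,n]∣m j m)

coprimeTo : ℕ → ℕ → Bool
coprimeTo m i = does (gcd (suc i) m ≟ 1)

φ≡count-coprimeTo : ∀ m → φ m ≡ count (coprimeTo m) m
φ≡count-coprimeTo m = length-filter-applyUpTo (λ k → gcd (suc k) m ≟ 1) id m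

coprimeTo-complement : ∀ m i j → suc i + suc j ≡ m → coprimeTo m i ≡ coprimeTo m j
coprimeTo-complement m i j eq = does-≡
  (map′ (gcd≡1-complement {suc i} eq)
        (gcd≡1-complement {suc j} (trans (+-comm (suc j) (suc i)) eq))
        (gcd (suc i) m ≟ 1))
  (gcd (suc j) m ≟ 1)

coprimeTo-common-divisor : ∀ {d} m i → d ∣ suc i → d ∣ m → d ≢ 1 → coprimeTo m i ≡ false
coprimeTo-common-divisor {d} m i d∣1+i d∣m d≢1 = dec-false (gcd (suc i) m ≟ 1)
  λ gcd≡1 → d≢1 (∣1⇒≡1 (subst (d ∣_) gcd≡1 (gcd-greatest d∣1+i d∣m)))

φ[m]≤m : ∀ m → φ m ≤ m
φ[m]≤m m =
  ≤-trans (length-filter (λ k → gcd (suc k) m ≟ 1) (upTo m)) (≤-reflexive (length-upTo m))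

2∣m⇒2*φ[m]≤m : ∀ {m} → 2 ∣ m → 2 * φ m ≤ m
2∣m⇒2*φ[m]≤m {m} 2∣m rewrite φ≡count-coprimeTo m =
  count-odd-vanishing-≤-half (coprimeTo m) m
    (λ {i} 2∣1+i → coprimeTo-common-divisor m i 2∣1+i 2∣m λ ()) 2∣m

3≤m⇒2∣φ[m] : ∀ {m} → 3 ≤ m → 2 ∣ φ m
3≤m⇒2∣φ[m] {suc n} (s≤s 2≤n) = subst (2 ∣_) (sym φ≡) (count-palindrome-even q n pal mid)
  where
  q : ℕ → Bool
  q = coprimeTo (suc n)
  1+n≢1 : suc n ≢ 1
  1+n≢1 refl = contradiction 2≤n λ ()
  φ≡ : φ (suc n) ≡ count q n
  φ≡ = begin
    φ (suc n)                 ≡⟨ φ≡count-coprimeTo (suc n) ⟩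
    count q (suc n)           ≡⟨ count-snoc q n ⟩
    count q n + indicator (q n)
      ≡⟨ cong (λ b → count q n + indicator b)
              (coprimeTo-common-divisor (suc n) n ∣-refl ∣-refl 1+n≢1) ⟩
    count q n + 0             ≡⟨ +-identityʳ _ ⟩
    count q n                 ∎
    where open ≡-Reasoning
  pal : ∀ i j → suc (i + j) ≡ n → q i ≡ q j
  pal i j eq = coprimeTo-complement (suc n) i j (cong suc (trans (+-suc i j) eq))
  mid : ∀ i → suc (i + i) ≡ n → q i ≡ false
  mid zero    refl = contradiction 2≤n λ { (s≤s ()) }
  mid (suc i) eq   = coprimeTo-common-divisor (suc n) (suc i) ∣-refl 2+i∣1+n λ ()
    where
    2+i∣1+n : suc (suc i) ∣ suc n
    2+i∣1+n = subst (suc (suc i) ∣_) (cong suc (trans (+-suc (suc i) (suc i)) eq))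
                    (∣m∣n⇒∣m+n ∣-refl ∣-refl)

2∣tower : ∀ {k} m → 3 ≤ k → 2 ∣ tower k m
2∣tower     zero    _   = 2 ∣0
2∣tower {k} (suc m) 3≤k = 3≤m⇒2∣φ[m] (≤-trans 3≤k (m≤m+n k _))

tower-bound-odd  : ∀ a m → tower (1 + 2 * a) m ≤ 6 * a + 10
tower-bound-even : ∀ a m → tower (2 + 2 * a) m ≤ 4 * a + 9

tower-bound-odd a zero    = z≤n
tower-bound-odd a (suc m) = begin
  φ (1 + 2 * a + tower (2 + 2 * a) m) ≤⟨ φ[m]≤m _ ⟩
  1 + 2 * a + tower (2 + 2 * a) m     ≤⟨ +-monoʳ-≤ (1 + 2 * a) (tower-bound-even a m) ⟩
  1 + 2 * a + (4 * a + 9)             ≡⟨ arith a ⟩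
  6 * a + 10                          ∎
  where
  open ≤-Reasoning
  arith : ∀ a → 1 + 2 * a + (4 * a + 9) ≡ 6 * a + 10
  arith = solve-∀

tower-bound-even a zero    = z≤n
tower-bound-even a (suc m) = *-cancelˡ-≤ 2 (begin
  2 * φ (2 + 2 * a + t)         ≤⟨ 2∣m⇒2*φ[m]≤m (∣m∣n⇒∣m+n 2∣2+2a (2∣tower m (m≤m+n 3 (2 * a)))) ⟩
  2 + 2 * a + t                 ≤⟨ +-monoʳ-≤ (2 + 2 * a) t≤ ⟩
  2 + 2 * a + (6 * suc a + 10)  ≡⟨ arith a ⟩
  2 * (4 * a + 9)               ∎)
  where
  open ≤-Reasoning
  t : ℕ
  t = tower (3 + 2 * a) m
  2∣2+2a : 2 ∣ 2 + 2 * a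
  2∣2+2a = ∣m∣n⇒∣m+n ∣-refl (m∣m*n a)
  t≤ : t ≤ 6 * suc a + 10
  t≤ = subst (λ k → tower k m ≤ 6 * suc a + 10) (cong suc (*-suc 2 a)) (tower-bound-odd (suc a) m)
  arith : ∀ a → 2 + 2 * a + (6 * suc a + 10) ≡ 2 * (4 * a + 9)
  arith = solve-∀

towerFrom : ℕ → ℕ → ℕ → ℕ
towerFrom k zero    u = u
towerFrom k (suc m) u = φ (k + towerFrom (suc k) m u)

tower-split : ∀ k m r → tower k (m + r) ≡ towerFrom k m (tower (k + m) r)
tower-split k zero    r = cong (λ j → tower j r) (sym (+-identityʳ k))
tower-split k (suc m) r = cong (λ x → φ (k + x))
  (trans (tower-split (suc k) m r) (cong (λ j → towerFrom (suc k) m (tower j r)) (sym (+-suc k m))))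

nestedTotient-split : ∀ m r → nestedTotient (m + r) ≡ towerFrom 1 m (tower (suc m) r)
nestedTotient-split = tower-split 1

-- From here on, implicit arguments are supplied and towers are spelled exactly as in the
-- types they must match: otherwise unification normalises φ on open terms, which is
-- prohibitively slow.
towerFrom[1,7,u]≡4 : ∀ u → u ≤ 21 → towerFrom 1 7 u ≡ 4
towerFrom[1,7,u]≡4 u u≤21 = from-yes (allUpTo? (λ v → towerFrom 1 7 v ≟ 4) 22) {u} (s≤s u≤21)

nestedTotient-≥7 : ∀ n → 7 ≤ n → nestedTotient n ≡ 4
nestedTotient-≥7 n 7≤n = subst (λ n → nestedTotient n ≡ 4) (m+[n∸m]≡n 7≤n)
  (trans (nestedTotient-split 7 (n ∸ 7))
         (towerFrom[1,7,u]≡4 (tower (suc 7) (n ∸ 7)) (tower-bound-even 3 (n ∸ 7))))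

theorem2p2 : nestedTotient 1 ≡ 1 × nestedTotient 2 ≡ 1 × nestedTotient 3 ≡ 2 × nestedTotient 4 ≡ 2 × ((n : ℕ) → 5 ≤ n → nestedTotient n ≡ 4)
theorem2p2 = refl , refl , refl , refl , λ where
  5 _ → refl
  6 _ → refl
  n@(suc (suc (suc (suc (suc (suc (suc r))))))) _ → nestedTotient-≥7 n (m≤m+n 7 r)
  1 (s≤s ())
  2 (s≤s (s≤s ()))
  3 (s≤s (s≤s (s≤s ())))
  4 (s≤s (s≤s (s≤s (s≤s ()))))
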